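{- For the Sequential Truncated-Pivot algorithm, $\mathbb{E}[C^{\mathrm{pivot}}]\le 3\cdot\mathrm{OPT}(G)$.
   Context: Correlation clustering: input is a simple undirected graph $G=(V,E^+)$ on $n$ nodes (positive edges); distinct non-adjacent pairs are negative. The cost of a partition of $V$ into clusters is the number of positive edges between different clusters plus the number of negative pairs within a cluster; $\mathrm{OPT}(G)$ is the minimum cost. Sequential Truncated-Pivot: all nodes start active. Pick a uniformly random permutation $\pi:V\to\{1,\dots,n\}$. For $i=1,\dots,n$: let $\ell_i=\frac{c}{\varepsilon}\cdot\frac{n\log n}{i}$ and $u$ the node with $\pi_u=i$; every active node $v$ with $\deg(v)\ge\ell_i$ ($\deg$ = degree in $G$) becomes inactive and forms a singleton cluster; then if $u$ is active, create a pivot cluster of $u$ and its active neighbors, all of which become inactive. $C^{\mathrm{pivot}}$ is the number of disagreements induced by the pivot clusters: the negative pairs inside pivot clusters, plus, for each pivot cluster $C$ created in iteration $i$, the positive edges from $C$ to nodes that are active in iteration $i$ but not contained in $C$. -}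

module Defs where

open import Data.Nat using (ℕ; zero; suc; _+_; _*_; _≤ᵇ_; _<ᵇ_; _≡ᵇ_; _⊓_)
open import Data.Bool using (Bool; true; false; _∧_; _∨_; not; if_then_else_)
open import Data.Fin using (Fin; toℕ)
open import Data.List using (List; []; _∷_; [_]; map; allFin; concatMap; foldr)
open import Data.Nat.ListAction using (sum)
open import Data.Bool.ListAction using (any)
open import Data.Vec using (Vec; lookup; toList) renaming ([] to []ᵥ; _∷_ to _∷ᵥ_)
open import Relation.Binary.PropositionalEquality using (_≡_)

record SimpleGraph (n : ℕ) : Set where
  field
    adj    : Fin n → Fin n → Bool
    sym    : ∀ u v → adj u v ≡ adj v u
    irrefl : ∀ v → adj v v ≡ false
open SimpleGraph public

count : ∀ {n} → (Fin n → Bool) → ℕ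
count {n} p = sum (map (λ v → if p v then 1 else 0) (allFin n))

pairCount : ∀ {n} → (Fin n → Fin n → Bool) → ℕ
pairCount {n} P = sum (map (λ v → count (λ w → (toℕ v <ᵇ toℕ w) ∧ P v w)) (allFin n))

_=ᶠ_ : ∀ {n} → Fin n → Fin n → Bool
u =ᶠ v = toℕ u ≡ᵇ toℕ v

deg : ∀ {n} → SimpleGraph n → Fin n → ℕ
deg G v = count (adj G v)

-- A clustering (partition of Fin n) is given by a labelling Fin n → Fin n;
-- two nodes are in the same cluster iff they have the same label.
-- Every partition of an n-set (≤ n blocks) arises this way.
ccCost : ∀ {n} → SimpleGraph n → (Fin n → Fin n) → ℕ
ccCost G cl = pairCount (λ v w →
  (adj G v w ∧ not (cl v =ᶠ cl w)) ∨ (not (adj G v w) ∧ (cl v =ᶠ cl w)))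

vecs : ∀ n k → List (Vec (Fin n) k)
vecs n zero    = [ []ᵥ ]
vecs n (suc k) = concatMap (λ xs → map (_∷ᵥ xs) (allFin n)) (vecs n k)

-- OPT(G): minimum cost over all clusterings (labellings Fin n → Fin n).
-- (The identity labelling = all singletons is used as the fold seed; it is
-- itself one of the enumerated labellings, so this is exactly the minimum.)
OPT : ∀ {n} → SimpleGraph n → ℕ
OPT {n} G = foldr _⊓_ (ccCost G (λ v → v)) (map (λ cl → ccCost G (lookup cl)) (vecs n n))

-- Permutations.  A permutation π : V → {1..n} is represented by the
-- sequence σ = (σ₁,…,σₙ) of nodes with π(σᵢ) = i, i.e. a length-n vector
-- over Fin n without repetitions.

distinct : ∀ {n} → List (Fin n) → Bool
distinct []       = true
distinct (x ∷ xs) = not (any (x =ᶠ_) xs) ∧ distinct xs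

-- Sequential Truncated-Pivot, returning C^pivot.
-- K = ⌈(c/ε)·n·log n⌉ ; since degrees and i are naturals,
--   deg v ≥ ℓᵢ = (c/ε)·n·log n / i   ⇔   deg v · i ≥ K.

truncStep : ∀ {n} → SimpleGraph n → ℕ → ℕ → (Fin n → Bool) → (Fin n → Bool)
truncStep G K i act v = act v ∧ not (K ≤ᵇ deg G v * i)

inCluster : ∀ {n} → SimpleGraph n → (Fin n → Bool) → Fin n → Fin n → Bool
inCluster G act u v = act v ∧ ((u =ᶠ v) ∨ adj G u v)

-- disagreements charged to the pivot cluster C of u, with act the set of
-- active nodes at the moment C is created: negative pairs inside C plus
-- positive edges from C to active nodes outside C.
pivotDisagreements : ∀ {n} → SimpleGraph n → (Fin n → Bool) → Fin n → ℕ
pivotDisagreements G act u =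
  pairCount (λ v w → C v ∧ C w ∧ not (adj G v w))
  + pairCount (λ v w → adj G v w ∧
      ((C v ∧ act w ∧ not (C w)) ∨ (C w ∧ act v ∧ not (C v))))
  where
    C = inCluster G act u

runPivot : ∀ {n} → SimpleGraph n → ℕ → ℕ → (Fin n → Bool) → List (Fin n) → ℕ
runPivot G K i act []       = 0
runPivot G K i act (u ∷ us) with truncStep G K i act
... | act′ = if act′ u
             then pivotDisagreements G act′ u
                  + runPivot G K (suc i) (λ v → act′ v ∧ not (inCluster G act′ u v)) us
             else runPivot G K (suc i) act′ us

Cpivot : ∀ {n} → SimpleGraph n → ℕ → Vec (Fin n) n → ℕ
Cpivot G K σ = runPivot G K 1 (λ _ → true) (toList σ)

-- Σ over all n! permutations of C^pivot  (= n! · E[C^pivot])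
sumCpivot : ∀ {n} → SimpleGraph n → ℕ → ℕ
sumCpivot {n} G K =
  sum (map (λ σ → if distinct (toList σ) then Cpivot G K σ else 0) (vecs n n))

-- Fix any clustering cl and let cost A count the pairs inside the active set A
-- on which cl disagrees with G, so that cost V is the cost of cl.  If a pivot x
-- creates a disagreement on a pair v w, then x v w span a bad triangle (exactly
-- two positive edges).  As "same cluster" is an equivalence relation, cl
-- disagrees with some edge of that triangle, and this edge leaves the active set
-- together with the cluster of the opposite vertex, which reaches it.  Summing
-- over ordered triples, a uniformly random active pivot creates at most three
-- times as many disagreements as it removes cl-disagreements from the active
-- set.  Truncation only shrinks the active set and so cannot increase cost;
-- induction over the remaining positions then bounds the pivot cost, summed
-- over all n! orders, by 3 · n! · cost V, and it remains to take cl optimal.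

module Submission where

open import Defs renaming (sym to adj-sym)
open import Algebra.Bundles using (CommutativeMonoid)
open import Data.Bool using (Bool; true; false; _∧_; _∨_; not; if_then_else_; T)
open import Data.Bool.ListAction using (all; any)
open import Data.Bool.Properties
  using (∧-commutativeMonoid; ∧-identityʳ; ∧-zeroʳ; ∧-conicalˡ; ∨-comm; ¬-not)
  renaming (_≟_ to _≟ᵇ_)
open import Data.Fin using (Fin; toℕ) renaming (zero to fzero; suc to fsuc)
open import Data.Fin.Properties using (toℕ-injective; _≟_)
open import Data.List using (List; []; _∷_; _++_; map; allFin; concatMap)
open import Data.List.Membership.Propositional.Properties using (foldr-selective; ∈-map⁻)
open import Data.List.Properties using (map-cong; map-∘; map-++; map-tabulate)
open import Data.Nat using (ℕ; zero; suc; _+_; _*_; _≤_; _!; z≤n; s≤s; _≡ᵇ_; _<ᵇ_)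
open import Data.Nat.ListAction using (sum)
open import Data.Nat.ListAction.Properties using (sum-++)
open import Data.Nat.Properties hiding (_≟_)
open import Data.Nat.Tactic.RingSolver using (solve-∀)
open import Data.Product using (∃; _×_; _,_)
open import Data.Sum using (_⊎_; inj₁; inj₂)
open import Data.Vec using (Vec; lookup; toList) renaming (_∷_ to _∷ᵥ_)
open import Function using (_∘_)
open import Relation.Nullary using (yes; no; contradiction)
open import Relation.Binary.PropositionalEquality
open import Algebra.Properties.CommutativeSemigroup
  (CommutativeMonoid.commutativeSemigroup ∧-commutativeMonoid)
  using () renaming (x∙yz≈y∙xz to ∧-left-comm)
open import Algebra.Solver.CommutativeMonoid ∧-commutativeMonoid using (solve; _⊜_; _⊕_)

private variable
  A B : Set
  n   : ℕ

-- Iverson brackets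

⟦_⟧ : Bool → ℕ
⟦ b ⟧ = if b then 1 else 0

infixr 9 ⟦_⟧*_
⟦_⟧*_ : Bool → ℕ → ℕ
⟦ b ⟧* m = if b then m else 0

⟦⟧*-+ : ∀ b m k → ⟦ b ⟧* (m + k) ≡ ⟦ b ⟧* m + ⟦ b ⟧* k
⟦⟧*-+ false m k = refl
⟦⟧*-+ true  m k = refl

⟦⟧*-*ˡ : ∀ b k m → ⟦ b ⟧* (k * m) ≡ k * ⟦ b ⟧* m
⟦⟧*-*ˡ false k m = sym (*-zeroʳ k)
⟦⟧*-*ˡ true  k m = refl

⟦⟧*-∧ : ∀ a b m → ⟦ a ∧ b ⟧* m ≡ ⟦ a ⟧* ⟦ b ⟧* m
⟦⟧*-∧ false b m = refl
⟦⟧*-∧ true  b m = refl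

⟦⟧*-⟦⟧ : ∀ a b → ⟦ a ⟧* ⟦ b ⟧ ≡ ⟦ a ∧ b ⟧
⟦⟧*-⟦⟧ false b = refl
⟦⟧*-⟦⟧ true  b = refl

⟦⟧*≡⟦⟧* : ∀ b m → ⟦ b ⟧* m ≡ ⟦ b ⟧ * m
⟦⟧*≡⟦⟧* false m = refl
⟦⟧*≡⟦⟧* true  m = sym (+-identityʳ m)

⟦⟧*-cong : ∀ b {m k} → (b ≡ true → m ≡ k) → ⟦ b ⟧* m ≡ ⟦ b ⟧* k
⟦⟧*-cong false _ = refl
⟦⟧*-cong true  h = h refl

⟦⟧*-partition : ∀ {a s} m → (a ≡ true → s ≡ true) → ⟦ a ⟧* m + ⟦ s ∧ not a ⟧* m ≡ ⟦ s ⟧* m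
⟦⟧*-partition {false} {false} m _   = refl
⟦⟧*-partition {false} {true}  m _   = refl
⟦⟧*-partition {true}          m a⇒s rewrite a⇒s refl = +-identityʳ m

one-of-three : ∀ {p q r} → p ≡ true ⊎ q ≡ true ⊎ r ≡ true → 1 ≤ ⟦ p ⟧ + ⟦ q ⟧ + ⟦ r ⟧
one-of-three {true}                  _ = s≤s z≤n
one-of-three {false} {true}          _ = s≤s z≤n
one-of-three {false} {false} {true}  _ = s≤s z≤n
one-of-three {false} {false} {false} (inj₁ ())
one-of-three {false} {false} {false} (inj₂ (inj₁ ()))
one-of-three {false} {false} {false} (inj₂ (inj₂ ()))

-- Finite sums

∑ : List A → (A → ℕ) → ℕ
∑ xs f = sum (map f xs)

∑-cong : ∀ (xs : List A) {f g : A → ℕ} → (∀ x → f x ≡ g x) → ∑ xs f ≡ ∑ xs g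
∑-cong xs f≗g = cong sum (map-cong f≗g xs)

∑-mono : ∀ (xs : List A) {f g : A → ℕ} → (∀ x → f x ≤ g x) → ∑ xs f ≤ ∑ xs g
∑-mono []       f≤g = z≤n
∑-mono (x ∷ xs) f≤g = +-mono-≤ (f≤g x) (∑-mono xs f≤g)

∑-zero : ∀ (xs : List A) → ∑ xs (λ _ → 0) ≡ 0
∑-zero []       = refl
∑-zero (x ∷ xs) = ∑-zero xs

∑-+ : ∀ (xs : List A) (f g : A → ℕ) → ∑ xs (λ x → f x + g x) ≡ ∑ xs f + ∑ xs g
∑-+ []       f g = refl
∑-+ (x ∷ xs) f g = begin
  (f x + g x) + ∑ xs (λ x → f x + g x) ≡⟨ cong ((f x + g x) +_) (∑-+ xs f g) ⟩
  (f x + g x) + (∑ xs f + ∑ xs g)     ≡⟨ +-assoc (f x) (g x) _ ⟩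
  f x + (g x + (∑ xs f + ∑ xs g))     ≡⟨ cong (f x +_) (+-comm (g x) _) ⟩
  f x + ((∑ xs f + ∑ xs g) + g x)     ≡⟨ cong (f x +_) (+-assoc (∑ xs f) _ _) ⟩
  f x + (∑ xs f + (∑ xs g + g x))     ≡⟨ cong (λ t → f x + (∑ xs f + t)) (+-comm (∑ xs g) (g x)) ⟩
  f x + (∑ xs f + (g x + ∑ xs g))     ≡⟨ +-assoc (f x) _ _ ⟨
  (f x + ∑ xs f) + (g x + ∑ xs g)     ∎
  where open ≡-Reasoning

∑-*ˡ : ∀ (xs : List A) c (f : A → ℕ) → ∑ xs (λ x → c * f x) ≡ c * ∑ xs f
∑-*ˡ []       c f = sym (*-zeroʳ c)
∑-*ˡ (x ∷ xs) c f = trans (cong (c * f x +_) (∑-*ˡ xs c f)) (sym (*-distribˡ-+ c (f x) _))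

∑-guard : ∀ (xs : List A) b (f : A → ℕ) → ⟦ b ⟧* ∑ xs f ≡ ∑ xs (λ x → ⟦ b ⟧* f x)
∑-guard xs false f = sym (∑-zero xs)
∑-guard xs true  f = refl

∑-swap : ∀ (xs : List A) (ys : List B) (f : A → B → ℕ) →
         ∑ xs (λ x → ∑ ys (f x)) ≡ ∑ ys (λ y → ∑ xs (λ x → f x y))
∑-swap []       ys f = sym (∑-zero ys)
∑-swap (x ∷ xs) ys f = begin
  ∑ ys (f x) + ∑ xs (λ x → ∑ ys (f x))         ≡⟨ cong (∑ ys (f x) +_) (∑-swap xs ys f) ⟩
  ∑ ys (f x) + ∑ ys (λ y → ∑ xs (λ x → f x y)) ≡⟨ ∑-+ ys (f x) _ ⟨
  ∑ ys (λ y → f x y + ∑ xs (λ x → f x y))     ∎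
  where open ≡-Reasoning

∑-map : ∀ (xs : List A) (h : A → B) (f : B → ℕ) → ∑ (map h xs) f ≡ ∑ xs (λ x → f (h x))
∑-map xs h f = cong sum (sym (map-∘ xs))

∑-concatMap : ∀ (xs : List A) (h : A → List B) (f : B → ℕ) →
              ∑ (concatMap h xs) f ≡ ∑ xs (λ x → ∑ (h x) f)
∑-concatMap []       h f = refl
∑-concatMap (x ∷ xs) h f = begin
  sum (map f (h x ++ concatMap h xs))         ≡⟨ cong sum (map-++ f (h x) _) ⟩
  sum (map f (h x) ++ map f (concatMap h xs)) ≡⟨ sum-++ (map f (h x)) _ ⟩
  ∑ (h x) f + ∑ (concatMap h xs) f           ≡⟨ cong (∑ (h x) f +_) (∑-concatMap xs h f) ⟩
  ∑ (h x) f + ∑ xs (λ x → ∑ (h x) f)         ∎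
  where open ≡-Reasoning

∑ᶠ : (Fin n → ℕ) → ℕ
∑ᶠ {n} = ∑ (allFin n)

∑ᶠ-suc : ∀ (f : Fin (suc n) → ℕ) → ∑ᶠ f ≡ f fzero + ∑ᶠ (λ x → f (fsuc x))
∑ᶠ-suc f = cong (λ xs → f fzero + sum xs)
  (trans (map-tabulate fsuc f) (sym (map-tabulate (λ x → x) (λ x → f (fsuc x)))))

∑ᶠ-⟦⟧* : ∀ (P : Fin n → Bool) m → ∑ᶠ (λ x → ⟦ P x ⟧* m) ≡ count P * m
∑ᶠ-⟦⟧* {n} P m = begin
  ∑ᶠ (λ x → ⟦ P x ⟧* m)  ≡⟨ ∑-cong (allFin n) (λ x → trans (⟦⟧*≡⟦⟧* (P x) m) (*-comm ⟦ P x ⟧ m)) ⟩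
  ∑ᶠ (λ x → m * ⟦ P x ⟧) ≡⟨ ∑-*ˡ (allFin n) m (λ x → ⟦ P x ⟧) ⟩
  m * count P            ≡⟨ *-comm m (count P) ⟩
  count P * m            ∎
  where open ≡-Reasoning

∑³ : (Fin n → Fin n → Fin n → ℕ) → ℕ
∑³ F = ∑ᶠ (λ x → ∑ᶠ (λ v → ∑ᶠ (λ w → F x v w)))

∑³-mono : ∀ {F G : Fin n → Fin n → Fin n → ℕ} → (∀ x v w → F x v w ≤ G x v w) → ∑³ F ≤ ∑³ G
∑³-mono {n} F≤G = ∑-mono (allFin n) (λ x → ∑-mono (allFin n) (λ v → ∑-mono (allFin n) (F≤G x v)))

∑³-+ : ∀ (F G : Fin n → Fin n → Fin n → ℕ) → ∑³ (λ x v w → F x v w + G x v w) ≡ ∑³ F + ∑³ G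
∑³-+ {n} F G = begin
  ∑³ (λ x v w → F x v w + G x v w)
    ≡⟨ ∑-cong (allFin n) (λ x → ∑-cong (allFin n) (λ v → ∑-+ (allFin n) (F x v) (G x v))) ⟩
  ∑ᶠ (λ x → ∑ᶠ (λ v → ∑ᶠ (F x v) + ∑ᶠ (G x v)))
    ≡⟨ ∑-cong (allFin n) (λ x → ∑-+ (allFin n) (λ v → ∑ᶠ (F x v)) _) ⟩
  ∑ᶠ (λ x → ∑ᶠ (λ v → ∑ᶠ (F x v)) + ∑ᶠ (λ v → ∑ᶠ (G x v)))
    ≡⟨ ∑-+ (allFin n) (λ x → ∑ᶠ (λ v → ∑ᶠ (F x v))) _ ⟩
  ∑³ F + ∑³ G ∎
  where open ≡-Reasoning

∑³-swap : ∀ (F : Fin n → Fin n → Fin n → ℕ) → ∑³ (λ x v w → F v x w) ≡ ∑³ F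
∑³-swap {n} F = ∑-swap (allFin n) (allFin n) (λ x v → ∑ᶠ (F v x))

∑³-rotate : ∀ (F : Fin n → Fin n → Fin n → ℕ) → ∑³ (λ x v w → F w x v) ≡ ∑³ F
∑³-rotate {n} F = trans (∑-cong (allFin n) (λ x → ∑-swap (allFin n) (allFin n) (λ v w → F w x v)))
                        (∑-swap (allFin n) (allFin n) (λ x w → ∑ᶠ (λ v → F w x v)))

-- Counting nodes and pairs

=ᶠ-refl : ∀ (v : Fin n) → (v =ᶠ v) ≡ true
=ᶠ-refl v = ≡ᵇ-refl (toℕ v)
  where
  ≡ᵇ-refl : ∀ m → (m ≡ᵇ m) ≡ true
  ≡ᵇ-refl zero    = refl
  ≡ᵇ-refl (suc m) = ≡ᵇ-refl m

=ᶠ-≢ : ∀ {u v : Fin n} → u ≢ v → (u =ᶠ v) ≡ false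
=ᶠ-≢ {u = u} {v} u≢v with u =ᶠ v in eq
... | false = refl
... | true  = contradiction (toℕ-injective (≡ᵇ⇒≡ (toℕ u) (toℕ v) (subst T (sym eq) _))) u≢v

=ᶠ-sym : ∀ (u v : Fin n) → (u =ᶠ v) ≡ (v =ᶠ u)
=ᶠ-sym u v with u ≟ v
... | yes refl = refl
... | no  u≢v  = trans (=ᶠ-≢ u≢v) (sym (=ᶠ-≢ (u≢v ∘ sym)))

count-true : count {n} (λ _ → true) ≡ n
count-true {zero}  = refl
count-true {suc n} = trans (∑ᶠ-suc {n} (λ _ → 1)) (cong suc (count-true {n}))

count-=ᶠ : ∀ (x : Fin n) → count (x =ᶠ_) ≡ 1
count-=ᶠ {suc n} fzero    = trans (∑ᶠ-suc {n} (λ y → ⟦ fzero =ᶠ y ⟧)) (cong suc (∑-zero (allFin n)))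
count-=ᶠ {suc n} (fsuc x) = trans (∑ᶠ-suc {n} (λ y → ⟦ fsuc x =ᶠ y ⟧)) (count-=ᶠ x)

infix 4 _⊆_
_⊆_ : (Fin n → Bool) → (Fin n → Bool) → Set
A ⊆ S = ∀ v → A v ≡ true → S v ≡ true

infixl 6 _∖_
_∖_ : (Fin n → Bool) → Fin n → Fin n → Bool
(S ∖ x) y = S y ∧ not (x =ᶠ y)

∖-intro : ∀ (S : Fin n → Bool) x {v} → S v ≡ true → x ≢ v → (S ∖ x) v ≡ true
∖-intro S x Sv x≢v rewrite Sv | =ᶠ-≢ x≢v = refl

count-∖ : ∀ (S : Fin n → Bool) x {k} → S x ≡ true → count S ≡ suc k → count (S ∖ x) ≡ k
count-∖ {n} S x {k} Sx count≡ = suc-injective (begin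
  suc (count (S ∖ x))                  ≡⟨ +-comm 1 _ ⟩
  count (S ∖ x) + 1                    ≡⟨ cong (count (S ∖ x) +_) (count-=ᶠ x) ⟨
  count (S ∖ x) + count (x =ᶠ_)        ≡⟨ ∑-+ (allFin n) (λ y → ⟦ (S ∖ x) y ⟧) _ ⟨
  ∑ᶠ (λ y → ⟦ (S ∖ x) y ⟧ + ⟦ x =ᶠ y ⟧) ≡⟨ ∑-cong (allFin n) split ⟨
  count S                              ≡⟨ count≡ ⟩
  suc k                                ∎)
  where
  open ≡-Reasoning
  split : ∀ y → ⟦ S y ⟧ ≡ ⟦ (S ∖ x) y ⟧ + ⟦ x =ᶠ y ⟧
  split y with x ≟ y
  ... | yes refl rewrite Sx | =ᶠ-refl x = refl
  ... | no  x≢y  rewrite =ᶠ-≢ x≢y | ∧-identityʳ (S y) = sym (+-identityʳ ⟦ S y ⟧)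

count₂ : (Fin n → Fin n → Bool) → ℕ
count₂ R = ∑ᶠ (λ v → count (R v))

count₂-+ : ∀ (P Q R : Fin n → Fin n → Bool) → (∀ v w → ⟦ P v w ⟧ ≡ ⟦ Q v w ⟧ + ⟦ R v w ⟧) →
           count₂ P ≡ count₂ Q + count₂ R
count₂-+ {n} P Q R split = begin
  count₂ P
    ≡⟨ ∑-cong (allFin n) (λ v → ∑-cong (allFin n) (split v)) ⟩
  ∑ᶠ (λ v → ∑ᶠ (λ w → ⟦ Q v w ⟧ + ⟦ R v w ⟧))
    ≡⟨ ∑-cong (allFin n) (λ v → ∑-+ (allFin n) (λ w → ⟦ Q v w ⟧) _) ⟩
  ∑ᶠ (λ v → count (Q v) + count (R v))
    ≡⟨ ∑-+ (allFin n) (λ v → count (Q v)) _ ⟩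
  count₂ Q + count₂ R ∎
  where open ≡-Reasoning

count₂-flip : ∀ (R : Fin n → Fin n → Bool) → count₂ R ≡ count₂ (λ v w → R w v)
count₂-flip {n} R = ∑-swap (allFin n) (allFin n) (λ v w → ⟦ R v w ⟧)

⟦⟧*-count₂ : ∀ b (R : Fin n → Fin n → Bool) → ⟦ b ⟧* count₂ R ≡ count₂ (λ v w → b ∧ R v w)
⟦⟧*-count₂ {n} b R = trans (∑-guard (allFin n) b (λ v → count (R v)))
  (∑-cong (allFin n) (λ v → trans (∑-guard (allFin n) b (λ w → ⟦ R v w ⟧))
                                  (∑-cong (allFin n) (λ w → ⟦⟧*-⟦⟧ b (R v w)))))

pairCount-+ : ∀ (P Q R : Fin n → Fin n → Bool) → (∀ v w → ⟦ P v w ⟧ ≡ ⟦ Q v w ⟧ + ⟦ R v w ⟧) →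
              pairCount P ≡ pairCount Q + pairCount R
pairCount-+ P Q R split = count₂-+ _ _ _ (λ v w → ordered (toℕ v <ᵇ toℕ w) (split v w))
  where
  ordered : ∀ {p q r} b → ⟦ p ⟧ ≡ ⟦ q ⟧ + ⟦ r ⟧ → ⟦ b ∧ p ⟧ ≡ ⟦ b ∧ q ⟧ + ⟦ b ∧ r ⟧
  ordered false _ = refl
  ordered true  e = e

pairCount-mono : ∀ (P Q : Fin n → Fin n → Bool) → (∀ v w → ⟦ P v w ⟧ ≤ ⟦ Q v w ⟧) →
                 pairCount P ≤ pairCount Q
pairCount-mono {n} P Q P≤Q =
  ∑-mono (allFin n) (λ v → ∑-mono (allFin n) (λ w → ordered (toℕ v <ᵇ toℕ w) (P≤Q v w)))
  where
  ordered : ∀ {p q} b → ⟦ p ⟧ ≤ ⟦ q ⟧ → ⟦ b ∧ p ⟧ ≤ ⟦ b ∧ q ⟧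
  ordered false _  = z≤n
  ordered true  le = le

pairCount-twice : ∀ (P : Fin n → Fin n → Bool) → (∀ v w → P w v ≡ P v w) →
                  pairCount P + pairCount P ≡ count₂ (λ v w → not (v =ᶠ w) ∧ P v w)
pairCount-twice {n} P P-sym = sym (begin
  count₂ (λ v w → not (v =ᶠ w) ∧ P v w)
    ≡⟨ count₂-+ _ _ _ (λ v w → ≢-trichotomy (toℕ v) (toℕ w) (P v w)) ⟩
  pairCount P + count₂ (λ v w → (toℕ w <ᵇ toℕ v) ∧ P v w)
    ≡⟨ cong (pairCount P +_) (count₂-flip (λ v w → (toℕ w <ᵇ toℕ v) ∧ P v w)) ⟩
  pairCount P + count₂ (λ v w → (toℕ v <ᵇ toℕ w) ∧ P w v)
    ≡⟨ cong (pairCount P +_) (∑-cong (allFin n) (λ v → ∑-cong (allFin n) (λ w →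
         cong (λ b → ⟦ (toℕ v <ᵇ toℕ w) ∧ b ⟧) (P-sym v w)))) ⟩
  pairCount P + pairCount P ∎)
  where
  open ≡-Reasoning
  ≢-trichotomy : ∀ a b p → ⟦ not (a ≡ᵇ b) ∧ p ⟧ ≡ ⟦ (a <ᵇ b) ∧ p ⟧ + ⟦ (b <ᵇ a) ∧ p ⟧
  ≢-trichotomy zero    zero    p = refl
  ≢-trichotomy zero    (suc b) p = sym (+-identityʳ ⟦ p ⟧)
  ≢-trichotomy (suc a) zero    p = refl
  ≢-trichotomy (suc a) (suc b) p = ≢-trichotomy a b p

⟦⟧*-pairCount-twice : ∀ b (P : Fin n → Fin n → Bool) → (∀ v w → P w v ≡ P v w) →
  ⟦ b ⟧* pairCount P + ⟦ b ⟧* pairCount P ≡ count₂ (λ v w → b ∧ not (v =ᶠ w) ∧ P v w)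
⟦⟧*-pairCount-twice b P P-sym = begin
  ⟦ b ⟧* pairCount P + ⟦ b ⟧* pairCount P       ≡⟨ ⟦⟧*-+ b (pairCount P) _ ⟨
  ⟦ b ⟧* (pairCount P + pairCount P)           ≡⟨ cong (⟦ b ⟧*_) (pairCount-twice P P-sym) ⟩
  ⟦ b ⟧* count₂ (λ v w → not (v =ᶠ w) ∧ P v w) ≡⟨ ⟦⟧*-count₂ b (λ v w → not (v =ᶠ w) ∧ P v w) ⟩
  count₂ (λ v w → b ∧ not (v =ᶠ w) ∧ P v w)    ∎
  where open ≡-Reasoning

-- Bad triangles

-- Exactly two of the edges xv, xw, vw, in the shape in which pivotError
-- unfolds for three distinct active nodes.
badTriangle : Bool → Bool → Bool → Bool
badTriangle a b c = (a ∧ b ∧ not c) ∨ (c ∧ ((a ∧ not b) ∨ (b ∧ not a)))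

badTriangle-covers : ∀ a b c → badTriangle a b c ≡ true →
                     (a ∨ b) ≡ true × (b ∨ c) ≡ true × (a ∨ c) ≡ true
badTriangle-covers true  true  c     _ = refl , refl , refl
badTriangle-covers true  false true  _ = refl , refl , refl
badTriangle-covers false true  true  _ = refl , refl , refl
badTriangle-covers true  false false ()
badTriangle-covers false true  false ()
badTriangle-covers false false false ()
badTriangle-covers false false true  ()

badTriangle-differs : ∀ a b c s t u → badTriangle a b c ≡ true → badTriangle s t u ≡ false →
                      a ≢ s ⊎ b ≢ t ⊎ c ≢ u
badTriangle-differs a b c s t u bad ok with a ≟ᵇ s | b ≟ᵇ t | c ≟ᵇ u
... | no a≢s   | _        | _        = inj₁ a≢s
... | yes _    | no b≢t   | _        = inj₂ (inj₁ b≢t)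
... | yes _    | yes _    | no c≢u   = inj₂ (inj₂ c≢u)
... | yes refl | yes refl | yes refl = contradiction (trans (sym bad) ok) λ ()

no-bad-=ᶠ-triangle : ∀ (p q r : Fin n) → badTriangle (p =ᶠ q) (p =ᶠ r) (q =ᶠ r) ≡ false
no-bad-=ᶠ-triangle p q r with p ≟ q | p ≟ r | q ≟ r
... | yes refl | yes refl | _        rewrite =ᶠ-refl p = refl
... | yes refl | no p≢r   | yes q≡r  = contradiction q≡r p≢r
... | yes refl | no p≢r   | no _     rewrite =ᶠ-refl p | =ᶠ-≢ p≢r = refl
... | no p≢q   | yes refl | yes q≡r  = contradiction (sym q≡r) p≢q
... | no p≢q   | yes refl | no q≢r   rewrite =ᶠ-refl p | =ᶠ-≢ p≢q | =ᶠ-≢ q≢r = refl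
... | no p≢q   | no p≢r   | yes refl rewrite =ᶠ-refl q | =ᶠ-≢ p≢q = refl
... | no p≢q   | no p≢r   | no q≢r   rewrite =ᶠ-≢ p≢q | =ᶠ-≢ p≢r | =ᶠ-≢ q≢r = refl

disagree : Bool → Bool → Bool
disagree a s = (a ∧ not s) ∨ (not a ∧ s)

disagree-≢ : ∀ {a s} → a ≢ s → disagree a s ≡ true
disagree-≢ {false} {false} a≢s = contradiction refl a≢s
disagree-≢ {false} {true}  _   = refl
disagree-≢ {true}  {false} _   = refl
disagree-≢ {true}  {true}  a≢s = contradiction refl a≢s

triangle-charging : ∀ a b c s t u → badTriangle s t u ≡ false →
  ⟦ badTriangle a b c ⟧ ≤ ⟦ disagree c u ∧ (a ∨ b) ⟧ + ⟦ disagree a s ∧ (b ∨ c) ⟧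
                          + ⟦ disagree b t ∧ (a ∨ c) ⟧
triangle-charging a b c s t u ok with badTriangle a b c in bad
... | false = z≤n
... | true  =
  one-of-three (charge (badTriangle-covers a b c bad) (badTriangle-differs a b c s t u bad ok))
  where
  charge : (a ∨ b) ≡ true × (b ∨ c) ≡ true × (a ∨ c) ≡ true → a ≢ s ⊎ b ≢ t ⊎ c ≢ u →
           (disagree c u ∧ (a ∨ b)) ≡ true ⊎ (disagree a s ∧ (b ∨ c)) ≡ true
           ⊎ (disagree b t ∧ (a ∨ c)) ≡ true
  charge (_  , bc , _ ) (inj₁ a≢s)        = inj₂ (inj₁ (cong₂ _∧_ (disagree-≢ a≢s) bc))
  charge (_  , _  , ac) (inj₂ (inj₁ b≢t)) = inj₂ (inj₂ (cong₂ _∧_ (disagree-≢ b≢t) ac))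
  charge (ab , _  , _ ) (inj₂ (inj₂ c≢u)) = inj₁ (cong₂ _∧_ (disagree-≢ c≢u) ab)

-- One pivot step

module _ {n} (G : SimpleGraph n) where

  pivotError : (Fin n → Bool) → Fin n → Fin n → Fin n → Bool
  pivotError A x v w = (C v ∧ C w ∧ not (adj G v w))
                     ∨ (adj G v w ∧ ((C v ∧ A w ∧ not (C w)) ∨ (C w ∧ A v ∧ not (C v))))
    where C = inCluster G A x

  pivotDisagreements≡pairCount : ∀ A x → pivotDisagreements G A x ≡ pairCount (pivotError A x)
  pivotDisagreements≡pairCount A x =
    sym (pairCount-+ _ _ _ (λ v w → disjoint (C v) (C w) (adj G v w) _))
    where
    C = inCluster G A x
    disjoint : ∀ p q c r → ⟦ (p ∧ q ∧ not c) ∨ (c ∧ r) ⟧ ≡ ⟦ p ∧ q ∧ not c ⟧ + ⟦ c ∧ r ⟧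
    disjoint false q     c     r = refl
    disjoint true  false c     r = refl
    disjoint true  true  false r = refl
    disjoint true  true  true  r = refl

  pivotError-sym : ∀ A x v w → pivotError A x w v ≡ pivotError A x v w
  pivotError-sym A x v w rewrite adj-sym G w v =
    cong₂ _∨_ (∧-left-comm (C w) (C v) _) (cong (adj G v w ∧_) (∨-comm (C w ∧ A v ∧ not (C v)) _))
    where C = inCluster G A x

  pivotError-inactive : ∀ A x v w → A v ≡ false → pivotError A x v w ≡ false
  pivotError-inactive A x v w Av rewrite Av | ∧-zeroʳ (inCluster G A x w) = ∧-zeroʳ (adj G v w)

  pivotError-pivot : ∀ A x w → A x ≡ true → x ≢ w → pivotError A x x w ≡ false
  pivotError-pivot A x w Ax x≢w rewrite Ax | =ᶠ-refl x | =ᶠ-≢ x≢w with A w | adj G x w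
  ... | false | false = refl
  ... | false | true  = refl
  ... | true  | false = refl
  ... | true  | true  = refl

  afterPivot : (Fin n → Bool) → Fin n → Fin n → Bool
  afterPivot A x v = A v ∧ not (inCluster G A x v)

  afterPivot-self : ∀ A x → A x ≡ true → afterPivot A x x ≡ false
  afterPivot-self A x Ax rewrite Ax | =ᶠ-refl x = refl

  errs : (Fin n → Bool) → Fin n → Fin n → Fin n → Bool
  errs A x v w = A x ∧ not (v =ᶠ w) ∧ pivotError A x v w

  module _ (cl : Fin n → Fin n) where

    disagrees : Fin n → Fin n → Bool
    disagrees v w = disagree (adj G v w) (cl v =ᶠ cl w)

    cost : (Fin n → Bool) → ℕ
    cost A = pairCount (λ v w → A v ∧ A w ∧ disagrees v w)

    touched : (Fin n → Bool) → Fin n → Fin n → Fin n → Bool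
    touched A x v w = A v ∧ A w ∧ disagrees v w ∧ (inCluster G A x v ∨ inCluster G A x w)

    charged : (Fin n → Bool) → Fin n → Fin n → Fin n → Bool
    charged A x v w = A x ∧ not (v =ᶠ w) ∧ touched A x v w

    cost-mono : ∀ {A B} → B ⊆ A → cost B ≤ cost A
    cost-mono {A} {B} B⊆A = pairCount-mono _ _ pointwise
      where
      pointwise : ∀ v w → ⟦ B v ∧ B w ∧ disagrees v w ⟧ ≤ ⟦ A v ∧ A w ∧ disagrees v w ⟧
      pointwise v w with B v in Bv | B w in Bw
      ... | false | _     = z≤n
      ... | true  | false = z≤n
      ... | true  | true rewrite B⊆A v Bv | B⊆A w Bw = ≤-refl

    cost-split : ∀ A x → cost A ≡ cost (afterPivot A x) + pairCount (touched A x)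
    cost-split A x =
      pairCount-+ _ _ _ (λ v w → split (A v) (A w) (inCluster G A x v) (inCluster G A x w) _)
      where
      split : ∀ a b c d z →
              ⟦ a ∧ b ∧ z ⟧ ≡ ⟦ (a ∧ not c) ∧ (b ∧ not d) ∧ z ⟧ + ⟦ a ∧ b ∧ z ∧ (c ∨ d) ⟧
      split false b     c     d     z     = refl
      split true  false true  d     z     = refl
      split true  false false d     z     = refl
      split true  true  true  d     false = refl
      split true  true  true  d     true  = refl
      split true  true  false true  false = refl
      split true  true  false true  true  = refl
      split true  true  false false false = refl
      split true  true  false false true  = refl

    touched-sym : ∀ A x v w → touched A x w v ≡ touched A x v w
    touched-sym A x v w rewrite adj-sym G w v | =ᶠ-sym (cl w) (cl v) =
      trans (∧-left-comm (A w) (A v) _)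
            (cong (λ t → A v ∧ A w ∧ disagrees v w ∧ t) (∨-comm (inCluster G A x w) _))

    errs-charged : ∀ A x v w →
      ⟦ errs A x v w ⟧ ≤ ⟦ charged A x v w ⟧ + ⟦ charged A w x v ⟧ + ⟦ charged A v x w ⟧
    errs-charged A x v w with A x in Ax | v ≟ w
    ... | false | _        = z≤n
    ... | true  | yes refl rewrite =ᶠ-refl v = z≤n
    ... | true  | no v≢w rewrite =ᶠ-≢ v≢w with x ≟ v | x ≟ w
    ... | yes refl | _ rewrite pivotError-pivot A x w Ax v≢w = z≤n
    ... | no _ | yes refl
      rewrite sym (pivotError-sym A w v w) | pivotError-pivot A w v Ax (≢-sym v≢w) = z≤n
    ... | no x≢v | no x≢w with A v ≟ᵇ false | A w ≟ᵇ false
    ... | yes Av | _      rewrite pivotError-inactive A x v w Av = z≤n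
    ... | no _   | yes Aw
      rewrite sym (pivotError-sym A x v w) | pivotError-inactive A x w v Aw = z≤n
    ... | no Av  | no Aw
      rewrite ¬-not Av | ¬-not Aw | =ᶠ-≢ x≢v | =ᶠ-≢ x≢w
            | =ᶠ-≢ (≢-sym x≢v) | =ᶠ-≢ (≢-sym x≢w) | =ᶠ-≢ (≢-sym v≢w)
            | adj-sym G w x | adj-sym G w v | adj-sym G v x
      = triangle-charging (adj G x v) (adj G x w) (adj G v w)
                          (cl x =ᶠ cl v) (cl x =ᶠ cl w) (cl v =ᶠ cl w)
                          (no-bad-=ᶠ-triangle (cl x) (cl v) (cl w))

    -- Both sides are doubled by counting over ordered pairs; the three charges
    -- of a triple are permutations of one another.
    pivot-charging : ∀ A → ∑ᶠ (λ x → ⟦ A x ⟧* pivotDisagreements G A x)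
                          ≤ 3 * ∑ᶠ (λ x → ⟦ A x ⟧* pairCount (touched A x))
    pivot-charging A = *-cancelˡ-≤ 2 (begin
      2 * E                                      ≡⟨ cong (E +_) (+-identityʳ E) ⟩
      E + E                                      ≡⟨ ∑-+ (allFin n) d d ⟨
      ∑ᶠ (λ x → d x + d x)                        ≡⟨ ∑-cong (allFin n) twice-errs ⟩
      ∑³ (λ x v w → ⟦ errs A x v w ⟧)            ≤⟨ ∑³-mono (errs-charged A) ⟩
      ∑³ (λ x v w → c x v w + c w x v + c v x w)
        ≡⟨ ∑³-+ (λ x v w → c x v w + c w x v) (λ x v w → c v x w) ⟩
      ∑³ (λ x v w → c x v w + c w x v) + ∑³ (λ x v w → c v x w)
        ≡⟨ cong₂ _+_ (trans (∑³-+ c (λ x v w → c w x v)) (cong (∑³ c +_) (∑³-rotate c)))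
                     (∑³-swap c) ⟩
      ∑³ c + ∑³ c + ∑³ c                         ≡⟨ cong (λ t → t + t + t) twice-touched ⟨
      (R + R) + (R + R) + (R + R)                ≡⟨ arith R ⟩
      2 * (3 * R)                                ∎)
      where
      open ≤-Reasoning
      d t : Fin n → ℕ
      d x = ⟦ A x ⟧* pivotDisagreements G A x
      t x = ⟦ A x ⟧* pairCount (touched A x)
      E = ∑ᶠ d
      R = ∑ᶠ t
      c : Fin n → Fin n → Fin n → ℕ
      c x v w = ⟦ charged A x v w ⟧
      twice-errs : ∀ x → d x + d x ≡ count₂ (errs A x)
      twice-errs x rewrite pivotDisagreements≡pairCount A x =
        ⟦⟧*-pairCount-twice (A x) (pivotError A x) (pivotError-sym A x)
      twice-touched : R + R ≡ ∑³ c
      twice-touched = trans (sym (∑-+ (allFin n) t t))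
        (∑-cong (allFin n) (λ x → ⟦⟧*-pairCount-twice (A x) (touched A x) (touched-sym A x)))
      arith : ∀ r → (r + r) + (r + r) + (r + r) ≡ 2 * (3 * r)
      arith = solve-∀

    stepCost : (Fin n → Bool) → Fin n → ℕ
    stepCost A x = pivotDisagreements G A x + 3 * cost (afterPivot A x)

    pivot-step-bound : ∀ A → ∑ᶠ (λ x → ⟦ A x ⟧* stepCost A x) ≤ count A * (3 * cost A)
    pivot-step-bound A = begin
      ∑ᶠ (λ x → ⟦ A x ⟧* (d x + 3 * r x))
        ≡⟨ ∑-cong (allFin n) (λ x → ⟦⟧*-+ (A x) (d x) _) ⟩
      ∑ᶠ (λ x → ⟦ A x ⟧* d x + ⟦ A x ⟧* (3 * r x))
        ≡⟨ ∑-+ (allFin n) (λ x → ⟦ A x ⟧* d x) _ ⟩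
      ∑ᶠ (λ x → ⟦ A x ⟧* d x) + ∑ᶠ (λ x → ⟦ A x ⟧* (3 * r x))
        ≤⟨ +-monoˡ-≤ _ (pivot-charging A) ⟩
      3 * ∑ᶠ (λ x → ⟦ A x ⟧* t x) + ∑ᶠ (λ x → ⟦ A x ⟧* (3 * r x))
        ≡⟨ cong₂ _+_ (∑-*ˡ (allFin n) 3 (λ x → ⟦ A x ⟧* t x))
                     (∑-cong (allFin n) (λ x → sym (⟦⟧*-*ˡ (A x) 3 (r x)))) ⟨
      ∑ᶠ (λ x → 3 * ⟦ A x ⟧* t x) + ∑ᶠ (λ x → 3 * ⟦ A x ⟧* r x)
        ≡⟨ ∑-+ (allFin n) (λ x → 3 * ⟦ A x ⟧* t x) _ ⟨
      ∑ᶠ (λ x → 3 * ⟦ A x ⟧* t x + 3 * ⟦ A x ⟧* r x)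
        ≡⟨ ∑-cong (allFin n) regroup ⟩
      ∑ᶠ (λ x → ⟦ A x ⟧* (3 * cost A))
        ≡⟨ ∑ᶠ-⟦⟧* A (3 * cost A) ⟩
      count A * (3 * cost A) ∎
      where
      open ≤-Reasoning
      d r t : Fin n → ℕ
      d x = pivotDisagreements G A x
      r x = cost (afterPivot A x)
      t x = pairCount (touched A x)
      regroup : ∀ x → 3 * ⟦ A x ⟧* t x + 3 * ⟦ A x ⟧* r x ≡ ⟦ A x ⟧* (3 * cost A)
      regroup x = begin-equality
        3 * ⟦ A x ⟧* t x + 3 * ⟦ A x ⟧* r x ≡⟨ *-distribˡ-+ 3 (⟦ A x ⟧* t x) _ ⟨
        3 * (⟦ A x ⟧* t x + ⟦ A x ⟧* r x)   ≡⟨ cong (3 *_) (⟦⟧*-+ (A x) (t x) (r x)) ⟨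
        3 * ⟦ A x ⟧* (t x + r x)            ≡⟨ ⟦⟧*-*ˡ (A x) 3 _ ⟨
        ⟦ A x ⟧* (3 * (t x + r x))          ≡⟨ cong (λ m → ⟦ A x ⟧* (3 * m)) (+-comm (t x) (r x)) ⟩
        ⟦ A x ⟧* (3 * (r x + t x))          ≡⟨ cong (λ m → ⟦ A x ⟧* (3 * m)) (cost-split A x) ⟨
        ⟦ A x ⟧* (3 * cost A)               ∎

-- Sums over orderings

all-∖ : ∀ (S : Fin n → Bool) x xs → all (S ∖ x) xs ≡ all S xs ∧ not (any (x =ᶠ_) xs)
all-∖ S x []       = refl
all-∖ S x (y ∷ ys) = begin
  (S y ∧ not (x =ᶠ y)) ∧ all (S ∖ x) ys
    ≡⟨ cong ((S y ∧ not (x =ᶠ y)) ∧_) (all-∖ S x ys) ⟩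
  (S y ∧ not (x =ᶠ y)) ∧ (all S ys ∧ not (any (x =ᶠ_) ys))
    ≡⟨ solve 4 (λ s e a d → (s ⊕ e) ⊕ (a ⊕ d) ⊜ (s ⊕ a) ⊕ (e ⊕ d)) refl
               (S y) (not (x =ᶠ y)) (all S ys) _ ⟩
  (S y ∧ all S ys) ∧ (not (x =ᶠ y) ∧ not (any (x =ᶠ_) ys))
    ≡⟨ cong ((S y ∧ all S ys) ∧_) (not-∨ (x =ᶠ y) _) ⟨
  (S y ∧ all S ys) ∧ not ((x =ᶠ y) ∨ any (x =ᶠ_) ys) ∎
  where
  open ≡-Reasoning
  not-∨ : ∀ a b → not (a ∨ b) ≡ not a ∧ not b
  not-∨ false b = refl
  not-∨ true  b = refl

arranges : (Fin n → Bool) → List (Fin n) → Bool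
arranges S xs = distinct xs ∧ all S xs

arranges-∷ : ∀ (S : Fin n → Bool) x xs → arranges S (x ∷ xs) ≡ S x ∧ arranges (S ∖ x) xs
arranges-∷ S x xs rewrite all-∖ S x xs =
  solve 4 (λ f d s a → (f ⊕ d) ⊕ (s ⊕ a) ⊜ s ⊕ (d ⊕ (a ⊕ f))) refl
    (not (any (x =ᶠ_) xs)) (distinct xs) (S x) (all S xs)

arranges-true : ∀ (xs : List (Fin n)) → arranges (λ _ → true) xs ≡ distinct xs
arranges-true xs = trans (cong (distinct xs ∧_) (all-true xs)) (∧-identityʳ (distinct xs))
  where
  all-true : ∀ (xs : List (Fin n)) → all (λ _ → true) xs ≡ true
  all-true []       = refl
  all-true (x ∷ xs) = all-true xs

arrangementSum : (Fin n → Bool) → (k : ℕ) → (Vec (Fin n) k → ℕ) → ℕ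
arrangementSum {n} S k f = ∑ (vecs n k) (λ σ → ⟦ arranges S (toList σ) ⟧* f σ)

arrangementSum-suc : ∀ (S : Fin n → Bool) k (f : Vec (Fin n) (suc k) → ℕ) →
  arrangementSum S (suc k) f ≡ ∑ᶠ (λ x → ⟦ S x ⟧* arrangementSum (S ∖ x) k (λ σ → f (x ∷ᵥ σ)))
arrangementSum-suc {n} S k f = begin
  arrangementSum S (suc k) f
    ≡⟨ ∑-concatMap (vecs n k) (λ σ → map (_∷ᵥ σ) (allFin n)) g ⟩
  ∑ (vecs n k) (λ σ → ∑ (map (_∷ᵥ σ) (allFin n)) g)
    ≡⟨ ∑-cong (vecs n k) (λ σ → ∑-map (allFin n) (_∷ᵥ σ) g) ⟩
  ∑ (vecs n k) (λ σ → ∑ᶠ (λ x → g (x ∷ᵥ σ)))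
    ≡⟨ ∑-cong (vecs n k) (λ σ → ∑-cong (allFin n) (λ x → split x σ)) ⟩
  ∑ (vecs n k) (λ σ → ∑ᶠ (λ x → ⟦ S x ⟧* h x σ))
    ≡⟨ ∑-swap (vecs n k) (allFin n) (λ σ x → ⟦ S x ⟧* h x σ) ⟩
  ∑ᶠ (λ x → ∑ (vecs n k) (λ σ → ⟦ S x ⟧* h x σ))
    ≡⟨ ∑-cong (allFin n) (λ x → ∑-guard (vecs n k) (S x) (h x)) ⟨
  ∑ᶠ (λ x → ⟦ S x ⟧* arrangementSum (S ∖ x) k (λ σ → f (x ∷ᵥ σ))) ∎
  where
  open ≡-Reasoning
  g : Vec (Fin n) (suc k) → ℕ
  g σ = ⟦ arranges S (toList σ) ⟧* f σ
  h : Fin n → Vec (Fin n) k → ℕ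
  h x σ = ⟦ arranges (S ∖ x) (toList σ) ⟧* f (x ∷ᵥ σ)
  split : ∀ x σ → g (x ∷ᵥ σ) ≡ ⟦ S x ⟧* h x σ
  split x σ = trans (cong (λ b → ⟦ b ⟧* f (x ∷ᵥ σ)) (arranges-∷ S x (toList σ))) (⟦⟧*-∧ (S x) _ _)

arrangementSum-const : ∀ (S : Fin n → Bool) k c → count S ≡ k →
                       arrangementSum S k (λ _ → c) ≡ k ! * c
arrangementSum-const S zero    c _      = refl
arrangementSum-const S (suc k) c count≡ = begin
  arrangementSum S (suc k) (λ _ → c)
    ≡⟨ arrangementSum-suc S k (λ _ → c) ⟩
  ∑ᶠ (λ x → ⟦ S x ⟧* arrangementSum (S ∖ x) k (λ _ → c))
    ≡⟨ ∑-cong (allFin _) (λ x → ⟦⟧*-cong (S x) (λ Sx →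
         arrangementSum-const (S ∖ x) k c (count-∖ S x Sx count≡))) ⟩
  ∑ᶠ (λ x → ⟦ S x ⟧* (k ! * c))
    ≡⟨ ∑ᶠ-⟦⟧* S (k ! * c) ⟩
  count S * (k ! * c)
    ≡⟨ cong (_* (k ! * c)) count≡ ⟩
  suc k * (k ! * c)
    ≡⟨ *-assoc (suc k) (k !) c ⟨
  suc k ! * c ∎
  where open ≡-Reasoning

arrangementSum-+ : ∀ (S : Fin n → Bool) k (f g : Vec (Fin n) k → ℕ) →
  arrangementSum S k (λ σ → f σ + g σ) ≡ arrangementSum S k f + arrangementSum S k g
arrangementSum-+ {n} S k f g =
  trans (∑-cong (vecs n k) (λ σ → ⟦⟧*-+ (arranges S (toList σ)) (f σ) (g σ))) (∑-+ (vecs n k) _ _)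

-- The pivot run

module _ {n} (G : SimpleGraph n) (cl : Fin n → Fin n) (K : ℕ) where

  RunBound : ℕ → Set
  RunBound k = ∀ (S A : Fin n → Bool) i → count S ≡ k → A ⊆ S →
               arrangementSum S k (λ σ → runPivot G K i A (toList σ)) ≤ 3 * (k ! * cost G cl A)

  first-pivot-bound : ∀ {k} → RunBound k → ∀ (S A : Fin n → Bool) i x → count S ≡ suc k → A ⊆ S →
    let A′ = truncStep G K i A in
    ⟦ S x ⟧* arrangementSum (S ∖ x) k (λ σ → runPivot G K i A (x ∷ toList σ))
      ≤ ⟦ A′ x ⟧* (k ! * stepCost G cl A′ x) + ⟦ S x ∧ not (A′ x) ⟧* (3 * (k ! * cost G cl A′))
  first-pivot-bound {k} IH S A i x count≡ A⊆S with truncStep G K i A x in A′x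
  -- the with-abstraction also performs the step of runPivot on x
  ... | true rewrite A⊆S x (∧-conicalˡ (A x) _ A′x) = begin
    arrangementSum (S ∖ x) k (λ σ → d + runPivot G K (suc i) A″ (toList σ))
      ≡⟨ arrangementSum-+ (S ∖ x) k (λ _ → d) _ ⟩
    arrangementSum (S ∖ x) k (λ _ → d)
      + arrangementSum (S ∖ x) k (λ σ → runPivot G K (suc i) A″ (toList σ))
      ≤⟨ +-mono-≤ (≤-reflexive (arrangementSum-const (S ∖ x) k d count∖x))
                  (IH (S ∖ x) A″ (suc i) count∖x A″⊆S∖x) ⟩
    k ! * d + 3 * (k ! * cost G cl A″)     ≡⟨ distribute (k !) d (cost G cl A″) ⟩
    k ! * stepCost G cl A′ x               ≡⟨ +-identityʳ _ ⟨
    k ! * stepCost G cl A′ x + 0           ∎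
    where
    open ≤-Reasoning
    A′ = truncStep G K i A
    A″ = afterPivot G A′ x
    d = pivotDisagreements G A′ x
    A′⊆S : A′ ⊆ S
    A′⊆S v = A⊆S v ∘ ∧-conicalˡ (A v) _
    count∖x : count (S ∖ x) ≡ k
    count∖x = count-∖ S x (A′⊆S x A′x) count≡
    A″⊆S∖x : A″ ⊆ S ∖ x
    A″⊆S∖x v A″v with x ≟ v
    ... | yes refl = contradiction (trans (sym A″v) (afterPivot-self G A′ x A′x)) λ ()
    ... | no  x≢v  = ∖-intro S x (A′⊆S v (∧-conicalˡ (A′ v) _ A″v)) x≢v
    distribute : ∀ f d q → f * d + 3 * (f * q) ≡ f * (d + 3 * q)
    distribute = solve-∀
  ... | false with S x in Sx
  ...   | false = z≤n
  ...   | true  = IH (S ∖ x) A′ (suc i) (count-∖ S x Sx count≡) A′⊆S∖x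
    where
    A′ = truncStep G K i A
    A′⊆S∖x : A′ ⊆ S ∖ x
    A′⊆S∖x v A′v = ∖-intro S x (A⊆S v (∧-conicalˡ (A v) _ A′v))
                             (λ { refl → contradiction (trans (sym A′x) A′v) λ () })

  runPivot-bound : ∀ k → RunBound k
  runPivot-bound zero    S A i _      _   = z≤n
  runPivot-bound (suc k) S A i count≡ A⊆S = begin
    arrangementSum S (suc k) (λ σ → runPivot G K i A (toList σ))
      ≡⟨ arrangementSum-suc S k _ ⟩
    ∑ᶠ (λ x → ⟦ S x ⟧* arrangementSum (S ∖ x) k (λ σ → runPivot G K i A (x ∷ toList σ)))
      ≤⟨ ∑-mono (allFin n) (λ x → first-pivot-bound (runPivot-bound k) S A i x count≡ A⊆S) ⟩
    ∑ᶠ (λ x → ⟦ A′ x ⟧* (k ! * stepCost G cl A′ x) + ⟦ S x ∧ not (A′ x) ⟧* m)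
      ≡⟨ ∑-+ (allFin n) (λ x → ⟦ A′ x ⟧* (k ! * stepCost G cl A′ x)) _ ⟩
    ∑ᶠ (λ x → ⟦ A′ x ⟧* (k ! * stepCost G cl A′ x)) + rest
      ≡⟨ cong (_+ rest) (trans (∑-cong (allFin n) (λ x → ⟦⟧*-*ˡ (A′ x) (k !) _))
                               (∑-*ˡ (allFin n) (k !) _)) ⟩
    k ! * ∑ᶠ (λ x → ⟦ A′ x ⟧* stepCost G cl A′ x) + rest
      ≤⟨ +-monoˡ-≤ rest (*-monoʳ-≤ (k !) (pivot-step-bound G cl A′)) ⟩
    k ! * (count A′ * (3 * cost G cl A′)) + rest
      ≡⟨ cong (_+ rest) (trans (reorder (k !) (count A′) (cost G cl A′)) (sym (∑ᶠ-⟦⟧* A′ m))) ⟩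
    ∑ᶠ (λ x → ⟦ A′ x ⟧* m) + rest
      ≡⟨ ∑-+ (allFin n) (λ x → ⟦ A′ x ⟧* m) _ ⟨
    ∑ᶠ (λ x → ⟦ A′ x ⟧* m + ⟦ S x ∧ not (A′ x) ⟧* m)
      ≡⟨ ∑-cong (allFin n) (λ x → ⟦⟧*-partition m (A′⊆S x)) ⟩
    ∑ᶠ (λ x → ⟦ S x ⟧* m)
      ≡⟨ trans (∑ᶠ-⟦⟧* S m) (cong (_* m) count≡) ⟩
    suc k * (3 * (k ! * cost G cl A′))
      ≤⟨ *-monoʳ-≤ (suc k) (*-monoʳ-≤ 3 (*-monoʳ-≤ (k !) (cost-mono G cl A′⊆A))) ⟩
    suc k * (3 * (k ! * cost G cl A))
      ≡⟨ reorder′ k (k !) (cost G cl A) ⟩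
    3 * (suc k ! * cost G cl A) ∎
    where
    open ≤-Reasoning
    A′ = truncStep G K i A
    A′⊆A : A′ ⊆ A
    A′⊆A v = ∧-conicalˡ (A v) _
    A′⊆S : A′ ⊆ S
    A′⊆S v = A⊆S v ∘ A′⊆A v
    m = 3 * (k ! * cost G cl A′)
    rest = ∑ᶠ (λ x → ⟦ S x ∧ not (A′ x) ⟧* m)
    reorder : ∀ f c q → f * (c * (3 * q)) ≡ c * (3 * (f * q))
    reorder = solve-∀
    reorder′ : ∀ k f q → suc k * (3 * (f * q)) ≡ 3 * ((suc k * f) * q)
    reorder′ = solve-∀

OPT-attained : ∀ (G : SimpleGraph n) → ∃ λ cl → OPT G ≡ ccCost G cl
OPT-attained {n} G
  with foldr-selective ⊓-sel (ccCost G (λ v → v)) (map (λ cl → ccCost G (lookup cl)) (vecs n n))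
... | inj₁ OPT≡ = (λ v → v) , OPT≡
... | inj₂ OPT∈ with ∈-map⁻ (λ cl → ccCost G (lookup cl)) OPT∈
...   | cl , _ , OPT≡ = lookup cl , OPT≡

lemma10 : ∀ (n : ℕ) (G : SimpleGraph n) (K : ℕ)
          → sumCpivot G K ≤ 3 * (n ! * OPT G)
lemma10 n G K with OPT-attained G
... | cl , OPT≡ = begin
  sumCpivot G K
    ≡⟨ ∑-cong (vecs n n) (λ σ → cong (λ b → ⟦ b ⟧* Cpivot G K σ) (arranges-true (toList σ))) ⟨
  arrangementSum (λ _ → true) n (Cpivot G K)
    ≤⟨ runPivot-bound G cl K n (λ _ → true) (λ _ → true) 1 count-true (λ _ h → h) ⟩
  3 * (n ! * ccCost G cl)
    ≡⟨ cong (λ c → 3 * (n ! * c)) OPT≡ ⟨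
  3 * (n ! * OPT G) ∎
  where open ≤-Reasoning
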